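{- Let $\ell\ge 3$ be an odd integer and let $c$ be the edge-coloring of the complete graph $K_{\ell+1}$ on vertex set $\{0,1,\dots,\ell\}$ with colors $\{0,1,\dots,\ell-1\}$ defined, for $0\le i<j\le \ell$, by $c(i,j)=2i \bmod \ell$ if $j=\ell$, and $c(i,j)=i+j\bmod \ell$ if $j<\ell$. Then $c$ is completely balanced (every vertex is incident to exactly one edge of each color) and $c$ contains no rainbow $K_m$, where $m=\lfloor\sqrt{\ell}+\tfrac{7}{2}\rfloor$.
   Context: A copy of $K_m$ is rainbow if all its edges receive distinct colors. -}

module Defs where

open import Data.Nat using (ℕ; zero; suc; _+_; _*_; _∸_; _^_; _≤_; _<_; _≡ᵇ_; NonZero)
open import Data.Nat.DivMod using (_%_)
open import Data.Nat.Properties using (_<?_)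
open import Data.Bool using (true; false)
open import Data.Fin using (Fin; toℕ)
open import Data.Product using (Σ; _×_; _,_)
open import Relation.Nullary using (¬_; yes; no)
open import Relation.Binary.PropositionalEquality using (_≡_)
open import Function.Definitions using (Injective)

cOrd : (ℓ : ℕ) .{{_ : NonZero ℓ}} → ℕ → ℕ → ℕ
cOrd ℓ i j with j ≡ᵇ ℓ
... | true  = (2 * i) % ℓ
... | false = (i + j) % ℓ

col : (ℓ : ℕ) .{{_ : NonZero ℓ}} → Fin (suc ℓ) → Fin (suc ℓ) → ℕ
col ℓ u v with toℕ u <? toℕ v
... | yes _ = cOrd ℓ (toℕ u) (toℕ v)
... | no  _ = cOrd ℓ (toℕ v) (toℕ u)

CompletelyBalanced : (ℓ : ℕ) .{{_ : NonZero ℓ}} → Set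
CompletelyBalanced ℓ =
  (v : Fin (suc ℓ)) (k : ℕ) → k < ℓ →
  Σ (Fin (suc ℓ)) λ u →
    (¬ (u ≡ v) × col ℓ v u ≡ k) ×
    ((w : Fin (suc ℓ)) → ¬ (w ≡ v) → col ℓ v w ≡ k → w ≡ u)

RainbowK : (ℓ : ℕ) .{{_ : NonZero ℓ}} → ℕ → Set
RainbowK ℓ m =
  Σ (Fin m → Fin (suc ℓ)) λ f →
    Injective _≡_ _≡_ f ×
    ((a b a' b' : Fin m) → toℕ a < toℕ b → toℕ a' < toℕ b' →
       col ℓ (f a) (f b) ≡ col ℓ (f a') (f b') → (a ≡ a') × (b ≡ b'))

-- m = ⌊√ℓ + 7/2⌋, characterised (uniquely) by
--   m ≤ √ℓ + 7/2 < m + 1,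
-- i.e. (2m - 7 ≤ 0 or (2m-7)² ≤ 4ℓ) and (2m - 5 > 0 and (2m-5)² > 4ℓ),
-- written with truncated subtraction.
IsFloorSqrtPlus7/2 : ℕ → ℕ → Set
IsFloorSqrtPlus7/2 ℓ m = ((2 * m ∸ 7) ^ 2 ≤ 4 * ℓ) × (4 * ℓ < (2 * m ∸ 5) ^ 2)

module Submission where

-- At a vertex v the ℓ edges to the other vertices receive pairwise distinct colours (for the
-- edges to the vertex ℓ because 2 is invertible modulo the odd ℓ), so each of the ℓ colours
-- occurs exactly once.
--
-- Let t_a (a < k) be the vertices below ℓ of a rainbow clique. Their sums t_a + t_b (a ≠ b) are
-- edge colours, hence distinct modulo ℓ. Call the ordered pair (a, b) good if a ≠ b and
-- 2 t_a ≢ t_b + t_c for all c ≠ b. On good pairs the difference t_a − t_b mod ℓ is nonzero and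
-- injective (a coincidence t_a − t_b ≡ t_c − t_e gives t_a + t_e ≡ t_b + t_c), so there are fewer
-- than ℓ good pairs. Each a has at most three bad partners b, and only a itself if the clique also
-- contains the vertex ℓ, since 2 t_a is then the colour of the edge from a to ℓ. Hence k² < ℓ + 3k
-- when the clique avoids ℓ (k = m) and k² < ℓ + k otherwise (k = m − 1); both contradict
-- 4ℓ < (2m − 5)².

open import Defs
open import Data.Bool using (true; false; T)
open import Data.Empty using (⊥-elim)
open import Data.Fin using (Fin; toℕ; fromℕ; fromℕ<; inject₁; punchIn; punchOut)
open import Data.Fin.Properties
  using (_≟_; any?; <-cmp; toℕ-injective; toℕ<n; toℕ-fromℕ; toℕ-fromℕ<; toℕ-inject₁; inject₁ℕ<;
         injective⇒≤; punchIn-injective; punchInᵢ≢i; punchOut-injective)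
open import Data.Fin.Relation.Unary.Top using (view; ‵fromℕ; ‵inject₁)
open import Data.List
  using (List; []; _∷_; _++_; length; map; filter; concatMap; cartesianProduct; allFin; upTo)
open import Data.List.Properties using (length-++; length-map; length-tabulate; length-upTo; filter-notAll)
open import Data.List.Membership.Propositional using (_∈_; lose)
open import Data.List.Membership.Propositional.Properties
  using (∈-filter⁺; ∈-filter⁻; ∈-upTo⁺; ∈-map⁺; ∈-++⁺ˡ; ∈-++⁺ʳ; ∈-concatMap⁺; ∈-allFin)
import Data.List.Relation.Unary.All as All
import Data.List.Relation.Unary.Any as Any
open import Data.List.Relation.Unary.Any using (here; there)
open import Data.List.Relation.Unary.AllPairs using (_∷_)
open import Data.List.Relation.Unary.Unique.Propositional using (Unique)
import Data.List.Relation.Unary.Unique.Propositional.Properties as Unique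
open import Data.Nat
  using (ℕ; suc; _+_; _*_; _∸_; _^_; _≤_; _<_; _≡ᵇ_; z≤n; s≤s; NonZero; >-nonZero⁻¹; _%_; _/_)
import Data.Nat as ℕ
open import Data.Nat.DivMod
  using (%-distribˡ-+; %-distribˡ-*; m%n%n≡m%n; [m+n]%n≡m%n; [m+kn]%n≡m%n; m<n⇒m%n≡m; m%n<n;
         m≡m%n+[m/n]*n)
open import Data.Nat.Properties
  using (_<?_; +-comm; +-assoc; +-identityʳ; *-identityʳ; *-suc; *-distribˡ-+; m+[n∸m]≡n;
         ≤-refl; ≤-reflexive; ≤-trans; ≤-<-trans; <-irrefl; <-asym; ≤-antisym; ≮⇒≥; <⇒≤; <⇒≢; n≮n;
         +-mono-≤; +-monoʳ-≤; +-monoˡ-<; *-monoʳ-≤; m≤m+n; ≡ᵇ⇒≡; ≡⇒≡ᵇ; ≤⇒≤ᵇ; ≤ᵇ⇒≤;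
         m≤n⇒∃[o]m+o≡n; module ≤-Reasoning)
open import Data.Nat.Tactic.RingSolver using (solve-∀)
open import Data.Product using (∃-syntax; _×_; _,_; proj₁; proj₂; swap)
import Data.Product as Product
open import Data.Product.Properties using (≡-dec)
open import Data.Sum using (_⊎_; inj₁; inj₂; [_,_]′)
import Data.Sum as Sum
open import Data.Unit using (tt)
open import Function using (_∘_; id)
open import Function.Definitions using (Injective; StrictlySurjective)
open import Relation.Binary.Definitions using (DecidableEquality; tri<; tri≈; tri>)
open import Relation.Binary.PropositionalEquality
open import Relation.Nullary using (¬_; Dec; yes; no; ¬?; contradiction)
open import Relation.Nullary.Decidable using (_×-dec_)
open import Relation.Unary using (Decidable)

module _ {a b} {A : Set a} {B : Set b} (_≟B_ : DecidableEquality B) (f : A → B) where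

  injection⇒length≤ : ∀ {xs ys} → Unique xs →
                      (∀ {x y} → x ∈ xs → y ∈ xs → f x ≡ f y → x ≡ y) →
                      (∀ {x} → x ∈ xs → f x ∈ ys) →
                      length xs ≤ length ys
  injection⇒length≤ {[]}     _                _   _    = z≤n
  injection⇒length≤ {x ∷ xs} {ys} (x∉xs ∷ xs-unique) inj into =
    ≤-<-trans (injection⇒length≤ xs-unique (λ p q → inj (there p) (there q)) into′)
              (filter-notAll P? ys (Any.map (λ fx≡y fx≢y → fx≢y fx≡y) (into (here refl))))
    where
    P? = λ y → ¬? (f x ≟B y)
    into′ : ∀ {y} → y ∈ xs → f y ∈ filter P? ys
    into′ y∈xs = ∈-filter⁺ P? (into (there y∈xs))
                   (All.lookup x∉xs y∈xs ∘ inj (here refl) (there y∈xs))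

length-cartesianProduct : ∀ {a b} {A : Set a} {B : Set b} (xs : List A) (ys : List B) →
                          length (cartesianProduct xs ys) ≡ length xs * length ys
length-cartesianProduct []       ys = refl
length-cartesianProduct (x ∷ xs) ys = begin
  length (map (x ,_) ys ++ cartesianProduct xs ys)         ≡⟨ length-++ (map (x ,_) ys) ⟩
  length (map (x ,_) ys) + length (cartesianProduct xs ys) ≡⟨ cong₂ _+_ (length-map (x ,_) ys)
                                                                        (length-cartesianProduct xs ys) ⟩
  length ys + length xs * length ys                        ∎
  where open ≡-Reasoning

length-concatMap≤ : ∀ {a b} {A : Set a} {B : Set b} (f : A → List B) {e} →
                    (∀ x → length (f x) ≤ e) → ∀ xs → length (concatMap f xs) ≤ length xs * e
length-concatMap≤ f     bound []       = z≤n
length-concatMap≤ f {e} bound (x ∷ xs) = begin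
  length (f x ++ concatMap f xs)         ≡⟨ length-++ (f x) ⟩
  length (f x) + length (concatMap f xs) ≤⟨ +-mono-≤ (bound x) (length-concatMap≤ f bound xs) ⟩
  e + length xs * e                      ∎
  where open ≤-Reasoning

injective⇒strictlySurjective : ∀ {n} {f : Fin n → Fin n} →
                               Injective _≡_ _≡_ f → StrictlySurjective _≡_ f
injective⇒strictlySurjective {suc n} {f} f-injective y with any? (λ x → f x ≟ y)
... | yes hit  = hit
... | no  miss = contradiction (injective⇒≤ g-injective) (n≮n n)
  where
  g : Fin (suc n) → Fin n
  g x = punchOut {i = y} (λ y≡fx → miss (x , sym y≡fx))
  g-injective : Injective _≡_ _≡_ g
  g-injective = f-injective ∘ punchOut-injective {i = y} _ _

length-allFin : ∀ n → length (allFin n) ≡ n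
length-allFin n = length-tabulate id

module GoodPairs {k : ℕ} (Good : Fin k → Fin k → Set) (good? : ∀ a b → Dec (Good a b)) where

  allPairs : List (Fin k × Fin k)
  allPairs = cartesianProduct (allFin k) (allFin k)

  allPairs-unique : Unique allPairs
  allPairs-unique = Unique.cartesianProduct⁺ (Unique.allFin⁺ k) (Unique.allFin⁺ k)

  isGood? : Decidable (λ (p : Fin k × Fin k) → Good (proj₁ p) (proj₂ p))
  isGood? (a , b) = good? a b

  goodPairs : List (Fin k × Fin k)
  goodPairs = filter isGood? allPairs

  BadPartnersAtMost : ℕ → Set
  BadPartnersAtMost e = ∀ a → ∃[ zs ] length zs ≤ e × (∀ b → ¬ Good a b → b ∈ zs)

  k*k≤length-goodPairs+k*e : ∀ {e} → BadPartnersAtMost e → k * k ≤ length goodPairs + k * e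
  k*k≤length-goodPairs+k*e {e} cover = begin
    k * k                                    ≡⟨ cong₂ _*_ (length-allFin k) (length-allFin k) ⟨
    length (allFin k) * length (allFin k)    ≡⟨ length-cartesianProduct (allFin k) (allFin k) ⟨
    length allPairs                          ≤⟨ injection⇒length≤ (≡-dec _≟_ _≟_) id allPairs-unique
                                                  (λ _ _ → id) covered ⟩
    length (goodPairs ++ badPairs)           ≡⟨ length-++ goodPairs ⟩
    length goodPairs + length badPairs       ≤⟨ +-monoʳ-≤ (length goodPairs)
                                                  (length-concatMap≤ partners length-partners≤e (allFin k)) ⟩
    length goodPairs + length (allFin k) * e ≡⟨ cong (λ n → length goodPairs + n * e) (length-allFin k) ⟩
    length goodPairs + k * e                 ∎
    where
    open ≤-Reasoning
    partners : Fin k → List (Fin k × Fin k)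
    partners a = map (a ,_) (proj₁ (cover a))
    length-partners≤e : ∀ a → length (partners a) ≤ e
    length-partners≤e a = ≤-trans (≤-reflexive (length-map (a ,_) (proj₁ (cover a))))
                                  (proj₁ (proj₂ (cover a)))
    badPairs = concatMap partners (allFin k)
    covered : ∀ {p} → p ∈ allPairs → p ∈ goodPairs ++ badPairs
    covered {a , b} p∈ with good? a b
    ... | yes good = ∈-++⁺ˡ (∈-filter⁺ isGood? p∈ good)
    ... | no  bad  = ∈-++⁺ʳ goodPairs (∈-concatMap⁺ partners
                       (lose (∈-allFin a) (∈-map⁺ (a ,_) (proj₂ (proj₂ (cover a)) b bad))))

  length-goodPairs<ℓ : ∀ {ℓ} .{{_ : NonZero ℓ}} (d : Fin k → Fin k → ℕ) →
                       (∀ a b → d a b < ℓ) → (∀ {a b} → Good a b → d a b ≢ 0) →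
                       (∀ {a b c e} → Good a b → Good c e → d a b ≡ d c e → (a , b) ≡ (c , e)) →
                       length goodPairs < ℓ
  length-goodPairs<ℓ {ℓ} d d<ℓ d≢0 d-injective = begin-strict
    length goodPairs  ≤⟨ injection⇒length≤ ℕ._≟_ (λ (a , b) → d a b)
                           (Unique.filter⁺ isGood? allPairs-unique)
                           (λ p∈ q∈ → d-injective (good p∈) (good q∈)) into ⟩
    length nonzero    <⟨ filter-notAll nonzero? (upTo ℓ)
                           (lose (∈-upTo⁺ (>-nonZero⁻¹ ℓ)) λ 0≢0 → 0≢0 refl) ⟩
    length (upTo ℓ)   ≡⟨ length-upTo ℓ ⟩
    ℓ                 ∎
    where
    open ≤-Reasoning
    nonzero? = λ n → ¬? (n ℕ.≟ 0)
    nonzero = filter nonzero? (upTo ℓ)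
    good : ∀ {p} → p ∈ goodPairs → Good (proj₁ p) (proj₂ p)
    good = proj₂ ∘ ∈-filter⁻ isGood? {xs = allPairs}
    into : ∀ {p} → p ∈ goodPairs → d (proj₁ p) (proj₂ p) ∈ nonzero
    into {a , b} p∈ = ∈-filter⁺ nonzero? (∈-upTo⁺ (d<ℓ a b)) (d≢0 (good p∈))

module _ (n : ℕ) .{{_ : NonZero n}} where

  %-absorbˡ : ∀ x y → (x % n + y) % n ≡ (x + y) % n
  %-absorbˡ x y = begin
    (x % n + y) % n         ≡⟨ %-distribˡ-+ (x % n) y n ⟩
    (x % n % n + y % n) % n ≡⟨ cong (λ z → (z + y % n) % n) (m%n%n≡m%n x n) ⟩
    (x % n + y % n) % n     ≡⟨ %-distribˡ-+ x y n ⟨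
    (x + y) % n             ∎
    where open ≡-Reasoning

  %-absorbʳ : ∀ x y → (x + y % n) % n ≡ (x + y) % n
  %-absorbʳ x y = begin
    (x + y % n) % n ≡⟨ cong (_% n) (+-comm x (y % n)) ⟩
    (y % n + x) % n ≡⟨ %-absorbˡ y x ⟩
    (y + x) % n     ≡⟨ cong (_% n) (+-comm y x) ⟩
    (x + y) % n     ∎
    where open ≡-Reasoning

  +-congʳ-% : ∀ {x y} z → x % n ≡ y % n → (x + z) % n ≡ (y + z) % n
  +-congʳ-% {x} {y} z eq = begin
    (x + z) % n     ≡⟨ %-absorbˡ x z ⟨
    (x % n + z) % n ≡⟨ cong (λ w → (w + z) % n) eq ⟩
    (y % n + z) % n ≡⟨ %-absorbˡ y z ⟩
    (y + z) % n     ∎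
    where open ≡-Reasoning

  *-congʳ-% : ∀ {x y} z → x % n ≡ y % n → (x * z) % n ≡ (y * z) % n
  *-congʳ-% {x} {y} z eq = begin
    (x * z) % n             ≡⟨ %-distribˡ-* x z n ⟩
    (x % n * (z % n)) % n   ≡⟨ cong (λ w → (w * (z % n)) % n) eq ⟩
    (y % n * (z % n)) % n   ≡⟨ %-distribˡ-* y z n ⟨
    (y * z) % n             ∎
    where open ≡-Reasoning

  x+[y+[n∸x]]≡y+n : ∀ {x} y → x ≤ n → x + (y + (n ∸ x)) ≡ y + n
  x+[y+[n∸x]]≡y+n {x} y x≤n = begin
    x + (y + (n ∸ x)) ≡⟨ x+[y+z]≡y+[x+z] x y (n ∸ x) ⟩
    y + (x + (n ∸ x)) ≡⟨ cong (y +_) (m+[n∸m]≡n x≤n) ⟩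
    y + n             ∎
    where
    open ≡-Reasoning
    x+[y+z]≡y+[x+z] : ∀ x y z → x + (y + z) ≡ y + (x + z)
    x+[y+z]≡y+[x+z] = solve-∀

  +-cancelˡ-% : ∀ {x y z} → x ≤ n → (x + y) % n ≡ (x + z) % n → y % n ≡ z % n
  +-cancelˡ-% {x} {y} {z} x≤n eq = begin
    y % n                   ≡⟨ shift y ⟨
    (x + y + (n ∸ x)) % n   ≡⟨ +-congʳ-% (n ∸ x) eq ⟩
    (x + z + (n ∸ x)) % n   ≡⟨ shift z ⟩
    z % n                   ∎
    where
    open ≡-Reasoning
    shift : ∀ w → (x + w + (n ∸ x)) % n ≡ w % n
    shift w = trans (cong (_% n) (trans (+-assoc x w (n ∸ x)) (x+[y+[n∸x]]≡y+n w x≤n)))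
                    ([m+n]%n≡m%n w n)

  [x+[y+[n∸x]]%n]%n≡y%n : ∀ {x} y → x ≤ n → (x + (y + (n ∸ x)) % n) % n ≡ y % n
  [x+[y+[n∸x]]%n]%n≡y%n {x} y x≤n = begin
    (x + (y + (n ∸ x)) % n) % n ≡⟨ %-absorbʳ x (y + (n ∸ x)) ⟩
    (x + (y + (n ∸ x))) % n     ≡⟨ cong (_% n) (x+[y+[n∸x]]≡y+n y x≤n) ⟩
    (y + n) % n                 ≡⟨ [m+n]%n≡m%n y n ⟩
    y % n                       ∎
    where open ≡-Reasoning

-- Multiplying by (ℓ + 1) / 2, the inverse of 2 modulo ℓ, recovers x from 2x.
double-injective-% : ∀ {ℓ} .{{_ : NonZero ℓ}} → ℓ % 2 ≡ 1 →
                     ∀ {x y} → x < ℓ → y < ℓ → (x + x) % ℓ ≡ (y + y) % ℓ → x ≡ y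
double-injective-% {ℓ} odd {x} {y} x<ℓ y<ℓ eq = begin
  x                      ≡⟨ m<n⇒m%n≡m x<ℓ ⟨
  x % ℓ                  ≡⟨ halve x ⟨
  ((x + x) * suc q) % ℓ  ≡⟨ *-congʳ-% ℓ (suc q) eq ⟩
  ((y + y) * suc q) % ℓ  ≡⟨ halve y ⟩
  y % ℓ                  ≡⟨ m<n⇒m%n≡m y<ℓ ⟩
  y                      ∎
  where
  open ≡-Reasoning
  q = ℓ / 2
  ℓ≡1+q*2 : ℓ ≡ 1 + q * 2
  ℓ≡1+q*2 = trans (m≡m%n+[m/n]*n ℓ 2) (cong (_+ q * 2) odd)
  expand : ∀ z p → (z + z) * suc p ≡ z + z * (1 + p * 2)
  expand = solve-∀
  halve : ∀ z → ((z + z) * suc q) % ℓ ≡ z % ℓ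
  halve z = begin
    ((z + z) * suc q) % ℓ     ≡⟨ cong (_% ℓ) (expand z q) ⟩
    (z + z * (1 + q * 2)) % ℓ ≡⟨ cong (λ n → (z + z * n) % ℓ) ℓ≡1+q*2 ⟨
    (z + z * ℓ) % ℓ           ≡⟨ [m+kn]%n≡m%n z z ℓ ⟩
    z % ℓ                     ∎

SameEdge : ∀ {a} {A : Set a} → A → A → A → A → Set a
SameEdge a b c e = (a ≡ c × b ≡ e) ⊎ (a ≡ e × b ≡ c)

SameEdge-injective : ∀ {a b} {A : Set a} {B : Set b} {f : A → B} → Injective _≡_ _≡_ f →
                     ∀ {x y z w} → SameEdge (f x) (f y) (f z) (f w) → SameEdge x y z w
SameEdge-injective f-inj = Sum.map (Product.map f-inj f-inj) (Product.map f-inj f-inj)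

module WeakSidon {ℓ : ℕ} .{{_ : NonZero ℓ}} {k : ℕ} (t : Fin k → ℕ) (t<ℓ : ∀ a → t a < ℓ)
  (doubles-injective : ∀ {a c} → (t a + t a) % ℓ ≡ (t c + t c) % ℓ → a ≡ c)
  (sums-injective : ∀ {a b c e} → a ≢ b → c ≢ e →
                    (t a + t b) % ℓ ≡ (t c + t e) % ℓ → SameEdge a b c e)
  where

  DoubleSum : Fin k → Fin k → Set
  DoubleSum a b = ∃[ c ] c ≢ b × (t a + t a) % ℓ ≡ (t b + t c) % ℓ

  doubleSum? : ∀ a b → Dec (DoubleSum a b)
  doubleSum? a b = any? λ c → ¬? (c ≟ b) ×-dec ((t a + t a) % ℓ ℕ.≟ (t b + t c) % ℓ)

  Good : Fin k → Fin k → Set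
  Good a b = a ≢ b × ¬ DoubleSum a b

  good? : ∀ a b → Dec (Good a b)
  good? a b = ¬? (a ≟ b) ×-dec ¬? (doubleSum? a b)

  ¬Good⇒≡⊎DoubleSum : ∀ {a b} → ¬ Good a b → a ≡ b ⊎ DoubleSum a b
  ¬Good⇒≡⊎DoubleSum {a} {b} ¬good with a ≟ b | doubleSum? a b
  ... | yes a≡b | _        = inj₁ a≡b
  ... | no  _   | yes sum  = inj₂ sum
  ... | no  a≢b | no  ¬sum = contradiction (a≢b , ¬sum) ¬good

  t-injective : ∀ {a c} → t a ≡ t c → a ≡ c
  t-injective eq = doubles-injective (cong (λ x → (x + x) % ℓ) eq)

  diff : Fin k → Fin k → ℕ
  diff a b = (t a + (ℓ ∸ t b)) % ℓ

  t+diff : ∀ a b → (t b + diff a b) % ℓ ≡ t a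
  t+diff a b = trans ([x+[y+[n∸x]]%n]%n≡y%n ℓ (t a) (<⇒≤ (t<ℓ b))) (m<n⇒m%n≡m (t<ℓ a))

  diff≢0 : ∀ {a b} → a ≢ b → diff a b ≢ 0
  diff≢0 {a} {b} a≢b diff≡0 = a≢b (t-injective (begin
    t a                   ≡⟨ t+diff a b ⟨
    (t b + diff a b) % ℓ  ≡⟨ cong (λ d → (t b + d) % ℓ) diff≡0 ⟩
    (t b + 0) % ℓ         ≡⟨ cong (_% ℓ) (+-identityʳ (t b)) ⟩
    t b % ℓ               ≡⟨ m<n⇒m%n≡m (t<ℓ b) ⟩
    t b                   ∎))
    where open ≡-Reasoning

  diff-cross : ∀ {a b c e} → diff a b ≡ diff c e → (t a + t e) % ℓ ≡ (t b + t c) % ℓ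
  diff-cross {a} {b} {c} {e} eq = begin
    (t a + t e) % ℓ                   ≡⟨ cong (λ x → (x + t e) % ℓ) (t+diff a b) ⟨
    ((t b + diff a b) % ℓ + t e) % ℓ  ≡⟨ %-absorbˡ ℓ (t b + diff a b) (t e) ⟩
    (t b + diff a b + t e) % ℓ        ≡⟨ cong (_% ℓ) (x+y+z≡x+[z+y] (t b) (diff a b) (t e)) ⟩
    (t b + (t e + diff a b)) % ℓ      ≡⟨ cong (λ d → (t b + (t e + d)) % ℓ) eq ⟩
    (t b + (t e + diff c e)) % ℓ      ≡⟨ %-absorbʳ ℓ (t b) (t e + diff c e) ⟨
    (t b + (t e + diff c e) % ℓ) % ℓ  ≡⟨ cong (λ x → (t b + x) % ℓ) (t+diff c e) ⟩
    (t b + t c) % ℓ                   ∎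
    where
    open ≡-Reasoning
    x+y+z≡x+[z+y] : ∀ x y z → x + y + z ≡ x + (z + y)
    x+y+z≡x+[z+y] = solve-∀

  diff-injective : ∀ {a b c e} → Good a b → Good c e → diff a b ≡ diff c e → (a , b) ≡ (c , e)
  diff-injective {a} {b} {c} {e} (a≢b , ¬sumab) (c≢e , ¬sumce) eq with diff-cross eq | a ≟ e | b ≟ c
  ... | cross | yes refl | yes refl = contradiction (doubles-injective cross) a≢b
  ... | cross | yes refl | no  b≢c  = contradiction (c , b≢c ∘ sym , cross) ¬sumab
  ... | cross | no  a≢e  | yes refl =
    contradiction (a , a≢e , trans (sym cross) (cong (_% ℓ) (+-comm (t a) (t e)))) ¬sumce
  ... | cross | no  a≢e  | no  b≢c  with sums-injective a≢e b≢c cross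
  ...   | inj₁ (a≡b , _)     = contradiction a≡b a≢b
  ...   | inj₂ (refl , refl) = refl

  open GoodPairs Good good? using (BadPartnersAtMost; k*k≤length-goodPairs+k*e; length-goodPairs<ℓ)

  k*k<ℓ+k*e : ∀ {e} → BadPartnersAtMost e → k * k < ℓ + k * e
  k*k<ℓ+k*e cover = ≤-<-trans (k*k≤length-goodPairs+k*e cover)
    (+-monoˡ-< _ (length-goodPairs<ℓ diff (λ a b → m%n<n _ ℓ) (diff≢0 ∘ proj₁) diff-injective))

  -- The bad partners of a are a itself and the unique pair {b, c} with t b + t c ≡ 2 t a, if any.
  badPartners≤3 : BadPartnersAtMost 3
  badPartners≤3 a with any? (doubleSum? a)
  ... | no ¬sum = a ∷ [] , s≤s z≤n , covered
    where
    covered : ∀ b → ¬ Good a b → b ∈ a ∷ []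
    covered b ¬good = [ here ∘ sym , ⊥-elim ∘ ¬sum ∘ (b ,_) ]′ (¬Good⇒≡⊎DoubleSum ¬good)
  ... | yes (b₁ , c₁ , c₁≢b₁ , 2a≡b₁+c₁) = a ∷ b₁ ∷ c₁ ∷ [] , ≤-refl , covered
    where
    covered : ∀ b → ¬ Good a b → b ∈ a ∷ b₁ ∷ c₁ ∷ []
    covered b ¬good with ¬Good⇒≡⊎DoubleSum ¬good
    ... | inj₁ a≡b = here (sym a≡b)
    ... | inj₂ (c , c≢b , 2a≡b+c)
      with sums-injective (c≢b ∘ sym) (c₁≢b₁ ∘ sym) (trans (sym 2a≡b+c) 2a≡b₁+c₁)
    ...   | inj₁ (b≡b₁ , _) = there (here b≡b₁)
    ...   | inj₂ (b≡c₁ , _) = there (there (here b≡c₁))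

  k*k<ℓ+k*3 : k * k < ℓ + k * 3
  k*k<ℓ+k*3 = k*k<ℓ+k*e badPartners≤3

  k*k<ℓ+k : (∀ a b → ¬ DoubleSum a b) → k * k < ℓ + k
  k*k<ℓ+k no-sum = subst (λ x → k * k < ℓ + x) (*-identityʳ k) (k*k<ℓ+k*e badPartners≤1)
    where
    badPartners≤1 : BadPartnersAtMost 1
    badPartners≤1 a = a ∷ [] , ≤-refl , covered
      where
      covered : ∀ b → ¬ Good a b → b ∈ a ∷ []
      covered b ¬good = [ here ∘ sym , ⊥-elim ∘ no-sum a b ]′ (¬Good⇒≡⊎DoubleSum ¬good)

≢fromℕ⇒inject₁ : ∀ {n} {v : Fin (suc n)} → v ≢ fromℕ n → ∃[ i ] v ≡ inject₁ i
≢fromℕ⇒inject₁ {v = v} v≢top with view v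
... | ‵fromℕ     = contradiction refl v≢top
... | ‵inject₁ i = i , refl

module _ {ℓ : ℕ} .{{_ : NonZero ℓ}} where

  cOrd<ℓ : ∀ i j → cOrd ℓ i j < ℓ
  cOrd<ℓ i j with j ≡ᵇ ℓ
  ... | true  = m%n<n (2 * i) ℓ
  ... | false = m%n<n (i + j) ℓ

  cOrd-finite : ∀ {i j} → j < ℓ → cOrd ℓ i j ≡ (i + j) % ℓ
  cOrd-finite {i} {j} j<ℓ with j ≡ᵇ ℓ in eq
  ... | true  = contradiction (≡ᵇ⇒≡ j ℓ (subst T (sym eq) tt)) (<⇒≢ j<ℓ)
  ... | false = refl

  cOrd-ℓ : ∀ i → cOrd ℓ i ℓ ≡ (i + i) % ℓ
  cOrd-ℓ i with ℓ ≡ᵇ ℓ in eq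
  ... | true  = cong (λ z → (i + z) % ℓ) (+-identityʳ i)
  ... | false = ⊥-elim (subst T eq (≡⇒≡ᵇ ℓ ℓ refl))

  col<ℓ : ∀ u v → col ℓ u v < ℓ
  col<ℓ u v with toℕ u <? toℕ v
  ... | yes _ = cOrd<ℓ (toℕ u) (toℕ v)
  ... | no  _ = cOrd<ℓ (toℕ v) (toℕ u)

  col-sym : ∀ u v → col ℓ u v ≡ col ℓ v u
  col-sym u v with toℕ u <? toℕ v | toℕ v <? toℕ u
  ... | yes u<v | yes v<u = contradiction v<u (<-asym u<v)
  ... | yes _   | no  _   = refl
  ... | no  _   | yes _   = refl
  ... | no  u≮v | no  v≮u = cong₂ (cOrd ℓ) v≡u (sym v≡u)
    where v≡u = ≤-antisym (≮⇒≥ u≮v) (≮⇒≥ v≮u)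

  col-finite : ∀ u v → toℕ u < ℓ → toℕ v < ℓ → col ℓ u v ≡ (toℕ u + toℕ v) % ℓ
  col-finite u v u<ℓ v<ℓ with toℕ u <? toℕ v
  ... | yes _ = cOrd-finite v<ℓ
  ... | no  _ = trans (cOrd-finite u<ℓ) (cong (_% ℓ) (+-comm (toℕ v) (toℕ u)))

  col-inject₁ : ∀ i j → col ℓ (inject₁ i) (inject₁ j) ≡ (toℕ i + toℕ j) % ℓ
  col-inject₁ i j = trans (col-finite (inject₁ i) (inject₁ j) (inject₁ℕ< i) (inject₁ℕ< j))
                          (cong₂ (λ x y → (x + y) % ℓ) (toℕ-inject₁ i) (toℕ-inject₁ j))

  col-inject₁-fromℕ : ∀ i → col ℓ (inject₁ i) (fromℕ ℓ) ≡ (toℕ i + toℕ i) % ℓ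
  col-inject₁-fromℕ i with toℕ (inject₁ i) <? toℕ (fromℕ ℓ)
  ... | yes _ = trans (cong₂ (cOrd ℓ) (toℕ-inject₁ i) (toℕ-fromℕ ℓ)) (cOrd-ℓ (toℕ i))
  ... | no  ≮ = contradiction (subst (toℕ (inject₁ i) <_) (sym (toℕ-fromℕ ℓ)) (inject₁ℕ< i)) ≮

  toℕ-+-cancelˡ-% : ∀ x {i j : Fin ℓ} → (toℕ x + toℕ i) % ℓ ≡ (toℕ x + toℕ j) % ℓ → i ≡ j
  toℕ-+-cancelˡ-% x {i} {j} eq = toℕ-injective (begin
    toℕ i     ≡⟨ m<n⇒m%n≡m (toℕ<n i) ⟨
    toℕ i % ℓ ≡⟨ +-cancelˡ-% ℓ (<⇒≤ (toℕ<n x)) eq ⟩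
    toℕ j % ℓ ≡⟨ m<n⇒m%n≡m (toℕ<n j) ⟩
    toℕ j     ∎)
    where open ≡-Reasoning

  col-inject₁-cancelˡ : ∀ x {i j} → col ℓ (inject₁ x) (inject₁ i) ≡ col ℓ (inject₁ x) (inject₁ j) → i ≡ j
  col-inject₁-cancelˡ x {i} {j} eq =
    toℕ-+-cancelˡ-% x (trans (sym (col-inject₁ x i)) (trans eq (col-inject₁ x j)))

  col[x,i]≡col[x,ℓ]⇒i≡x : ∀ x {i} → col ℓ (inject₁ x) (inject₁ i) ≡ col ℓ (inject₁ x) (fromℕ ℓ) → i ≡ x
  col[x,i]≡col[x,ℓ]⇒i≡x x {i} eq =
    toℕ-+-cancelˡ-% x (trans (sym (col-inject₁ x i)) (trans eq (col-inject₁-fromℕ x)))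

module _ {ℓ : ℕ} .{{_ : NonZero ℓ}} (odd : ℓ % 2 ≡ 1) where

  col-fromℕ-cancelˡ : ∀ {i j} → col ℓ (fromℕ ℓ) (inject₁ i) ≡ col ℓ (fromℕ ℓ) (inject₁ j) → i ≡ j
  col-fromℕ-cancelˡ {i} {j} eq = toℕ-injective (double-injective-% odd (toℕ<n i) (toℕ<n j) (begin
    (toℕ i + toℕ i) % ℓ         ≡⟨ col-inject₁-fromℕ i ⟨
    col ℓ (inject₁ i) (fromℕ ℓ) ≡⟨ col-sym (inject₁ i) (fromℕ ℓ) ⟩
    col ℓ (fromℕ ℓ) (inject₁ i) ≡⟨ eq ⟩
    col ℓ (fromℕ ℓ) (inject₁ j) ≡⟨ col-sym (fromℕ ℓ) (inject₁ j) ⟩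
    col ℓ (inject₁ j) (fromℕ ℓ) ≡⟨ col-inject₁-fromℕ j ⟩
    (toℕ j + toℕ j) % ℓ         ∎))
    where open ≡-Reasoning

  col-injective : ∀ v {w w′} → w ≢ v → w′ ≢ v → col ℓ v w ≡ col ℓ v w′ → w ≡ w′
  col-injective v {w} {w′} w≢v w′≢v eq with view v | view w | view w′
  ... | ‵fromℕ     | ‵fromℕ     | _          = contradiction refl w≢v
  ... | ‵fromℕ     | _          | ‵fromℕ     = contradiction refl w′≢v
  ... | ‵fromℕ     | ‵inject₁ _ | ‵inject₁ _ = cong inject₁ (col-fromℕ-cancelˡ eq)
  ... | ‵inject₁ x | ‵inject₁ _ | ‵inject₁ _ = cong inject₁ (col-inject₁-cancelˡ x eq)
  ... | ‵inject₁ x | ‵inject₁ _ | ‵fromℕ     = contradiction (cong inject₁ (col[x,i]≡col[x,ℓ]⇒i≡x x eq)) w≢v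
  ... | ‵inject₁ x | ‵fromℕ     | ‵inject₁ _ = contradiction (cong inject₁ (col[x,i]≡col[x,ℓ]⇒i≡x x (sym eq))) w′≢v
  ... | ‵inject₁ _ | ‵fromℕ     | ‵fromℕ     = refl

  balanced : CompletelyBalanced ℓ
  balanced v k k<ℓ = u , (u≢v , col-vu≡k) , λ w w≢v col-vw≡k →
    col-injective v w≢v u≢v (trans col-vw≡k (sym col-vu≡k))
    where
    colourAt : Fin ℓ → Fin ℓ
    colourAt i = fromℕ< (col<ℓ v (punchIn v i))
    toℕ-colourAt : ∀ i → toℕ (colourAt i) ≡ col ℓ v (punchIn v i)
    toℕ-colourAt i = toℕ-fromℕ< (col<ℓ v (punchIn v i))
    colourAt-injective : Injective _≡_ _≡_ colourAt
    colourAt-injective {i} {j} eq = punchIn-injective v i j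
      (col-injective v (punchInᵢ≢i v i) (punchInᵢ≢i v j)
        (trans (sym (toℕ-colourAt i)) (trans (cong toℕ eq) (toℕ-colourAt j))))
    preimage : ∃[ i ] colourAt i ≡ fromℕ< k<ℓ
    preimage = injective⇒strictlySurjective colourAt-injective (fromℕ< k<ℓ)
    u = punchIn v (proj₁ preimage)
    u≢v = punchInᵢ≢i v (proj₁ preimage)
    col-vu≡k : col ℓ v u ≡ k
    col-vu≡k = trans (sym (toℕ-colourAt _)) (trans (cong toℕ (proj₂ preimage)) (toℕ-fromℕ< k<ℓ))

module Rainbow {ℓ : ℕ} .{{_ : NonZero ℓ}} (odd : ℓ % 2 ≡ 1)
  {m} {f : Fin m → Fin (suc ℓ)} (f-injective : Injective _≡_ _≡_ f)
  (rainbow : (a b a′ b′ : Fin m) → toℕ a < toℕ b → toℕ a′ < toℕ b′ →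
             col ℓ (f a) (f b) ≡ col ℓ (f a′) (f b′) → (a ≡ a′) × (b ≡ b′))
  where

  edges-distinct : ∀ {i j i′ j′} → i ≢ j → i′ ≢ j′ →
                   col ℓ (f i) (f j) ≡ col ℓ (f i′) (f j′) → SameEdge i j i′ j′
  edges-distinct {i} {j} {i′} {j′} i≢j i′≢j′ eq with <-cmp i j | <-cmp i′ j′
  ... | tri≈ _ i≡j _ | _              = contradiction i≡j i≢j
  ... | _            | tri≈ _ i′≡j′ _ = contradiction i′≡j′ i′≢j′
  ... | tri< i<j _ _ | tri< i′<j′ _ _ = inj₁ (rainbow i j i′ j′ i<j i′<j′ eq)
  ... | tri< i<j _ _ | tri> _ _ j′<i′ =
    inj₂ (rainbow i j j′ i′ i<j j′<i′ (trans eq (col-sym (f i′) (f j′))))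
  ... | tri> _ _ j<i | tri< i′<j′ _ _ =
    inj₂ (swap (rainbow j i i′ j′ j<i i′<j′ (trans (col-sym (f j) (f i)) eq)))
  ... | tri> _ _ j<i | tri> _ _ j′<i′ =
    inj₁ (swap (rainbow j i j′ i′ j<i j′<i′
                 (trans (col-sym (f j) (f i)) (trans eq (col-sym (f i′) (f j′))))))

  module FiniteVertices {k} {ι : Fin k → Fin m} (ι-injective : Injective _≡_ _≡_ ι)
                        (finite : ∀ a → f (ι a) ≢ fromℕ ℓ) where

    g : Fin k → Fin ℓ
    g a = proj₁ (≢fromℕ⇒inject₁ (finite a))

    f∘ι≡inject₁∘g : ∀ a → f (ι a) ≡ inject₁ (g a)
    f∘ι≡inject₁∘g a = proj₂ (≢fromℕ⇒inject₁ (finite a))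

    t : Fin k → ℕ
    t = toℕ ∘ g

    col-ι : ∀ a b → col ℓ (f (ι a)) (f (ι b)) ≡ (t a + t b) % ℓ
    col-ι a b = trans (cong₂ (col ℓ) (f∘ι≡inject₁∘g a) (f∘ι≡inject₁∘g b))
                      (col-inject₁ (g a) (g b))

    col-ι-fromℕ : ∀ {x} → f x ≡ fromℕ ℓ → ∀ a → col ℓ (f (ι a)) (f x) ≡ (t a + t a) % ℓ
    col-ι-fromℕ fx≡top a = trans (cong₂ (col ℓ) (f∘ι≡inject₁∘g a) fx≡top)
                                 (col-inject₁-fromℕ (g a))

    doubles-injective : ∀ {a c} → (t a + t a) % ℓ ≡ (t c + t c) % ℓ → a ≡ c
    doubles-injective {a} {c} eq = ι-injective (f-injective (begin
      f (ι a)       ≡⟨ f∘ι≡inject₁∘g a ⟩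
      inject₁ (g a) ≡⟨ cong inject₁ (toℕ-injective t[a]≡t[c]) ⟩
      inject₁ (g c) ≡⟨ f∘ι≡inject₁∘g c ⟨
      f (ι c)       ∎))
      where
      open ≡-Reasoning
      t[a]≡t[c] = double-injective-% odd (toℕ<n (g a)) (toℕ<n (g c)) eq

    sums-injective : ∀ {a b c e} → a ≢ b → c ≢ e →
                     (t a + t b) % ℓ ≡ (t c + t e) % ℓ → SameEdge a b c e
    sums-injective {a} {b} {c} {e} a≢b c≢e eq = SameEdge-injective ι-injective
      (edges-distinct (a≢b ∘ ι-injective) (c≢e ∘ ι-injective)
                      (trans (col-ι a b) (trans eq (sym (col-ι c e)))))

    open WeakSidon t (toℕ<n ∘ g) doubles-injective sums-injective public

rainbow-bound : ∀ {ℓ} .{{_ : NonZero ℓ}} → ℓ % 2 ≡ 1 → ∀ {k} → RainbowK ℓ (suc k) →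
                suc k * suc k < ℓ + suc k * 3 ⊎ k * k < ℓ + k
rainbow-bound {ℓ} odd (f , f-injective , rainbow) with any? (λ x → f x ≟ fromℕ ℓ)
... | no top∉f = inj₁ (FiniteVertices.k*k<ℓ+k*3 {ι = id} id (λ a fa≡top → top∉f (a , fa≡top)))
  where open Rainbow odd f-injective rainbow
... | yes (x , fx≡top) = inj₂ (k*k<ℓ+k no-doubleSum)
  where
  open Rainbow odd f-injective rainbow
  open FiniteVertices {ι = punchIn x} (punchIn-injective x _ _)
              (λ a fιa≡top → punchInᵢ≢i x a (f-injective (trans fιa≡top (sym fx≡top))))
  no-doubleSum : ∀ a b → ¬ DoubleSum a b
  no-doubleSum a b (c , c≢b , eq)
    with edges-distinct (punchInᵢ≢i x a) (c≢b ∘ sym ∘ punchIn-injective x b c)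
                        (trans (col-ι-fromℕ fx≡top a) (trans eq (sym (col-ι b c))))
  ... | inj₁ (_ , x≡ιc) = punchInᵢ≢i x c (sym x≡ιc)
  ... | inj₂ (_ , x≡ιb) = punchInᵢ≢i x b (sym x≡ιb)

4ℓ≮c≤9 : ∀ {ℓ c} → 3 ≤ ℓ → c ≤ 9 → ¬ 4 * ℓ < c
4ℓ≮c≤9 3≤ℓ c≤9 4ℓ<c = ≤⇒≤ᵇ (≤-trans (s≤s (*-monoʳ-≤ 4 3≤ℓ)) (≤-trans 4ℓ<c c≤9))

5≤m : ∀ {ℓ} m → 3 ≤ ℓ → 4 * ℓ < (2 * m ∸ 5) ^ 2 → 5 ≤ m
5≤m (suc (suc (suc (suc (suc _))))) _ _ = s≤s (s≤s (s≤s (s≤s (s≤s z≤n))))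
5≤m 0 3≤ℓ 4ℓ<c = ⊥-elim (4ℓ≮c≤9 3≤ℓ z≤n 4ℓ<c)
5≤m 1 3≤ℓ 4ℓ<c = ⊥-elim (4ℓ≮c≤9 3≤ℓ z≤n 4ℓ<c)
5≤m 2 3≤ℓ 4ℓ<c = ⊥-elim (4ℓ≮c≤9 3≤ℓ z≤n 4ℓ<c)
5≤m 3 3≤ℓ 4ℓ<c = ⊥-elim (4ℓ≮c≤9 3≤ℓ (≤ᵇ⇒≤ 1 9 tt) 4ℓ<c)
5≤m 4 3≤ℓ 4ℓ<c = ⊥-elim (4ℓ≮c≤9 3≤ℓ ≤-refl 4ℓ<c)

x<ℓ+y∧z+4y≤4x+4⇒4ℓ≮z : ∀ {ℓ x y z} → x < ℓ + y → z + 4 * y ≤ 4 * x + 4 → ¬ 4 * ℓ < z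
x<ℓ+y∧z+4y≤4x+4⇒4ℓ≮z {ℓ} {x} {y} {z} x<ℓ+y z+4y≤4x+4 4ℓ<z = <-irrefl refl (begin-strict
  4 * x + 4     ≡⟨ trans (+-comm (4 * x) 4) (sym (*-suc 4 x)) ⟩
  4 * suc x     ≤⟨ *-monoʳ-≤ 4 x<ℓ+y ⟩
  4 * (ℓ + y)   ≡⟨ *-distribˡ-+ 4 ℓ y ⟩
  4 * ℓ + 4 * y <⟨ +-monoˡ-< (4 * y) 4ℓ<z ⟩
  z + 4 * y     ≤⟨ z+4y≤4x+4 ⟩
  4 * x + 4     ∎)
  where open ≤-Reasoning

-- The solver handles neither ∸ nor ^, so the identities state (2 * (5 + n) ∸ 5) ^ 2 in the
-- form it unfolds to by computation.
m*m<ℓ+m*3⇒4ℓ≮[2m∸5]² : ∀ {ℓ} n → let m = 5 + n in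
                       m * m < ℓ + m * 3 → ¬ 4 * ℓ < (2 * m ∸ 5) ^ 2
m*m<ℓ+m*3⇒4ℓ≮[2m∸5]² {ℓ} n bound = x<ℓ+y∧z+4y≤4x+4⇒4ℓ≮z {ℓ} {m * m} {m * 3} bound
  (subst ((2 * m ∸ 5) ^ 2 + 4 * (m * 3) ≤_) (identity n) (m≤m+n _ (8 * n + 19)))
  where
  m = 5 + n
  identity : ∀ n → (n + (5 + n + 0)) * ((n + (5 + n + 0)) * 1) + 4 * ((5 + n) * 3) + (8 * n + 19)
                 ≡ 4 * ((5 + n) * (5 + n)) + 4
  identity = solve-∀

[m∸1]²<ℓ+[m∸1]⇒4ℓ≮[2m∸5]² : ∀ {ℓ} n → let k = 4 + n in
                            k * k < ℓ + k → ¬ 4 * ℓ < (2 * suc k ∸ 5) ^ 2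
[m∸1]²<ℓ+[m∸1]⇒4ℓ≮[2m∸5]² {ℓ} n bound = x<ℓ+y∧z+4y≤4x+4⇒4ℓ≮z {ℓ} {k * k} {k} bound
  (subst ((2 * suc k ∸ 5) ^ 2 + 4 * k ≤_) (identity n) (m≤m+n _ (8 * n + 27)))
  where
  k = 4 + n
  identity : ∀ n → (n + (5 + n + 0)) * ((n + (5 + n + 0)) * 1) + 4 * (4 + n) + (8 * n + 27)
                 ≡ 4 * ((4 + n) * (4 + n)) + 4
  identity = solve-∀

lemma4 : (ℓ : ℕ) .{{_ : NonZero ℓ}} → 3 ≤ ℓ → ℓ % 2 ≡ 1 →
    (m : ℕ) → IsFloorSqrtPlus7/2 ℓ m →
    CompletelyBalanced ℓ × ¬ RainbowK ℓ m
lemma4 ℓ 3≤ℓ odd m (_ , 4ℓ<[2m∸5]²) with m≤n⇒∃[o]m+o≡n (5≤m m 3≤ℓ 4ℓ<[2m∸5]²)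
... | n , refl = balanced odd , λ rainbow →
  [ (λ bound → m*m<ℓ+m*3⇒4ℓ≮[2m∸5]² n bound 4ℓ<[2m∸5]²)
  , (λ bound → [m∸1]²<ℓ+[m∸1]⇒4ℓ≮[2m∸5]² n bound 4ℓ<[2m∸5]²) ]′ (rainbow-bound odd rainbow)
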